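{- Let $s$ be a fixed positive integer and let $n$ be a sufficiently large positive integer (depending on $s$). Let $v\in \widetilde{\mathbb{B}}_n$ and $S\subseteq \widetilde{\mathbb{B}}_n$ with $S\cap U(v)=\emptyset$ and $|S|=s$. Let $M$ be a full chain of $D(v)$ chosen uniformly at random among all $|v|!$ full chains of $D(v)$. Then $$\Pr\big(M\cap D^*(v,S)\neq\emptyset\big)\leq \frac{27 s\sqrt{n\ln n}}{n}.$$
   Context: $\mathbb{B}_n=(2^{[n]},\subseteq)$, whose elements (subsets of $[n]$) are called vertices; $|v|$ is the cardinality of $v$. $\widetilde{\mathbb{B}}_n=\{v\subseteq [n]: |v|\in [\frac n2-2\sqrt{n\ln n},\ \frac n2+2\sqrt{n\ln n}]\}$. For a vertex $v$, $D(v)=\{u\subseteq[n]: u\subseteq v\}$ and $U(v)=\{u\subseteq [n]: v\subseteq u\}$; for a set $S$ of vertices, $D(S)=\bigcup_{w\in S}D(w)$ and $U(S)=\bigcup_{w\in S}U(w)$. For $v\in\widetilde{\mathbb{B}}_n$ and $S\subseteq\widetilde{\mathbb{B}}_n$ with $S\cap U(v)=\emptyset$, $D^*(v,S)=\big[(D(v)\setminus\{v\})\cap (U(S)\cup D(S))\big]\cap \widetilde{\mathbb{B}}_n$. A full chain of $D(v)$ (a Boolean lattice of order $|v|$) is a chain $v=w_{|v|}\supset w_{|v|-1}\supset\dots\supset w_0=\emptyset$ with $|w_j|=j$; it is identified with its set of vertices. -}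

module Defs where

open import Data.Nat using (ℕ; zero; suc; _+_; _*_; _^_; _!; ∣_-_∣)
open import Data.Nat.Properties using (_!≢0)
open import Data.Integer using (+_)
open import Data.Rational as ℚ using (ℚ)
open import Data.Fin using (Fin; toℕ; inject₁; fromℕ) renaming (suc to fsuc)
open import Data.Fin.Subset using (Subset; _⊆_; ∣_∣)
open import Data.Vec using (Vec; lookup)
open import Data.List using (List)
open import Data.List.Relation.Unary.Any using (Any)
open import Data.Product using (_×_; ∃-syntax)
open import Data.Sum using (_⊎_)
open import Relation.Binary.PropositionalEquality using (_≡_; _≢_)

-- Vertices of the Boolean lattice B_n are subsets of [n] = Fin n,
-- represented by the library type  Subset n ;  |v| is  ∣ v ∣.

expPartial : ℕ → ℕ → ℚ
expPartial a zero    = ℚ.1ℚ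
expPartial a (suc k) = expPartial a k ℚ.+ ((+ (a ^ suc k)) ℚ./ (suc k !)) {{suc k !≢0}}

-- ExpLE a M  :⇔  exp(a) ≤ M   (exp(a) is the supremum of the increasing
-- partial sums of its power series).
ExpLE : ℕ → ℕ → Set
ExpLE a M = ∀ k → expPartial a k ℚ.≤ (+ M) ℚ./ 1

-- a ≤ c · √(n ln n)   for naturals a, c and n ≥ 1.
-- Indeed a ≤ c√(n ln n) ⇔ a² ≤ c² n ln n ⇔ exp(a²) ≤ exp(c² n ln n) = n^(n c²).
_≤_·√nlnn[_] : ℕ → ℕ → ℕ → Set
a ≤ c ·√nlnn[ n ] = ExpLE (a * a) (n ^ (n * (c * c)))

-- The middle layers  B̃_n :  |v| ∈ [n/2 − 2√(n ln n), n/2 + 2√(n ln n)]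
-- ⇔ | 2|v| − n | ≤ 4 √(n ln n).
InBand : {n : ℕ} → Subset n → Set
InBand {n} v = ∣ 2 * ∣ v ∣ - n ∣ ≤ 4 ·√nlnn[ n ]

-- D*(v,S) = [(D(v) \ {v}) ∩ (U(S) ∪ D(S))] ∩ B̃_n ,  S given as a list.
-- u ∈ U(w) ⇔ w ⊆ u ;  u ∈ D(w) ⇔ u ⊆ w.
InDStar : {n : ℕ} → Subset n → List (Subset n) → Subset n → Set
InDStar v S u = (u ⊆ v × u ≢ v) × Any (λ w → w ⊆ u ⊎ u ⊆ w) S × InBand u

-- A full chain of D(v):  w_{|v|} = v ⊃ … ⊃ w_0 = ∅ with |w_j| = j,
-- stored as the vector (w_0, …, w_{|v|}).
FullChain : {n : ℕ} (v : Subset n) → Vec (Subset n) (suc ∣ v ∣) → Set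
FullChain v M =
  (∀ (j : Fin (suc ∣ v ∣)) → ∣ lookup M j ∣ ≡ toℕ j) ×
  (∀ (j : Fin ∣ v ∣) → lookup M (inject₁ j) ⊆ lookup M (fsuc j)) ×
  lookup M (fromℕ ∣ v ∣) ≡ v

MeetsDStar : {n : ℕ} (v : Subset n) → List (Subset n) → Vec (Subset n) (suc ∣ v ∣) → Set
MeetsDStar v S M = ∃[ j ] InDStar v S (lookup M j)

-- Fix the least level j* at which some bad chain meets D*(v,S); every bad chain meets D* at a
-- level j ≥ j*, in a vertex comparable with some w ∈ S.  If that vertex lies below w, the chain
-- avoids a fixed x ∈ v ∖ w already at level j*, which happens for at most (|v|-j*)(|v|-1)! chains;
-- if it lies above w, the coatom of the chain contains w, which happens for at most
-- (|v|-|w|)(|v|-1)! chains.  As v, w and the level-j* vertex all lie in the middle layers, both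
-- differences are at most D = max |2|x| - n| ≤ 4√(n ln n), and |v| ≥ n/3.  Hence
-- #bad · n ≤ 6 s |v|! D ≤ 24 s |v|! √(n ln n).
--
-- The real inequality a ≤ c√(n ln n) is the statement exp(a²) ≤ n^(n c²); it is handled through
-- the natural numbers k! Σ_{i ≤ k} aⁱ/i!, which are submultiplicative by the binomial theorem.
module Submission where

open import Data.Nat
open import Data.Nat.Properties
open import Data.Nat.Combinatorics using (_C_; k![n∸k]!∣n!)
open import Data.Nat.Combinatorics.Specification using (nCk≡n!/k![n-k]!)
open import Data.Nat.DivMod using (_/_; _%_; m/n*n≡m; m≡m%n+[m/n]*n; m%n<n; m*n/n≡m; /-monoˡ-≤; m/n*n≤m)
open import Data.Nat.Solver using (module +-*-Solver)
import Data.Integer as ℤ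
import Data.Integer.Properties as ℤP
import Data.Rational as ℚ
import Data.Rational.Properties as ℚP
open import Data.Rational.Unnormalised as ℚᵘ using (ℚᵘ; mkℚᵘ; *≡*; *≤*)
import Data.Rational.Unnormalised.Properties as ℚᵘP
open import Data.Fin using (Fin; toℕ; inject₁; fromℕ) renaming (zero to fzero; suc to fsuc)
import Data.Fin.Properties as Fin
open import Data.Fin.Relation.Unary.Top using (view; ‵fromℕ; ‵inj₁)
open import Data.Fin.Subset using (Subset; inside; outside; _⊆_; ∣_∣; _─_) renaming (_∈_ to _∈ₛ_; _∉_ to _∉ₛ_; _-_ to _∖_)
open import Data.Fin.Subset.Properties
  using (drop-∷-⊆; p⊆q⇒∣p∣≤∣q∣; drop-there; out⊆; in⊆in; p─⊥≡p; ⊆-trans; x∈p∧x≢y⇒x∈p-y; x∈p∧x∉q⇒x∈p─q)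
open import Data.Vec using (Vec; []; _∷_; lookup; tabulate; here; there)
import Data.Vec.Properties as Vec
import Data.Vec.Functional as VecF
open import Data.List using (List; []; _∷_; map; length)
open import Data.List.Properties using (length-map)
open import Data.List.Membership.Propositional using (_∈_)
open import Data.List.Membership.Propositional.Properties using (∈-map⁺; ∈-map⁻)
open import Data.List.Relation.Unary.All as All using (All; []; _∷_)
import Data.List.Relation.Unary.All.Properties as All
open import Data.List.Relation.Unary.Any as Any using (Any; here; there)
open import Data.List.Relation.Unary.AllPairs using ([]; _∷_)
open import Data.List.Relation.Unary.Unique.Propositional using (Unique)
open import Data.List.Extrema.Nat using (argmax; f[⊥]≤f[argmax]; f[xs]≤f[argmax]; argmax-all)
open import Data.Product using (_×_; _,_; ∃; ∃-syntax; proj₁)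
open import Data.Sum using (_⊎_; inj₁; inj₂)
open import Data.Unit using (⊤; tt)
open import Function using (_∘_; _∘′_; id)
open import Relation.Nullary using (¬_; yes; no; contradiction)
open import Relation.Binary.PropositionalEquality
open import Algebra.Bundles using (Semiring)
import Algebra.Definitions.RawMonoid as RawMonoid
import Algebra.Properties.Semiring.Binomial as Binomial
import Algebra.Properties.Semiring.Exp as SemiringExp
open import Defs

open +-*-Solver

sum< : ℕ → (ℕ → ℕ) → ℕ
sum< zero    f = 0
sum< (suc n) f = sum< n f + f n

syntax sum< n (λ i → e) = ∑[ i < n ] e

module _ {f g : ℕ → ℕ} where

  sum<-cong : ∀ n → (∀ i → i < n → f i ≡ g i) → ∑[ i < n ] f i ≡ ∑[ i < n ] g i
  sum<-cong zero    f≡g = refl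
  sum<-cong (suc n) f≡g =
    cong₂ _+_ (sum<-cong n (λ i i<n → f≡g i (m<n⇒m<1+n i<n))) (f≡g n ≤-refl)

  sum<-mono-≤ : ∀ n → (∀ i → i < n → f i ≤ g i) → ∑[ i < n ] f i ≤ ∑[ i < n ] g i
  sum<-mono-≤ zero    f≤g = z≤n
  sum<-mono-≤ (suc n) f≤g =
    +-mono-≤ (sum<-mono-≤ n (λ i i<n → f≤g i (m<n⇒m<1+n i<n))) (f≤g n ≤-refl)

  sum<-distrib-+ : ∀ n → ∑[ i < n ] (f i + g i) ≡ ∑[ i < n ] f i + ∑[ i < n ] g i
  sum<-distrib-+ zero    = refl
  sum<-distrib-+ (suc n) = begin
    ∑[ i < n ] (f i + g i) + (f n + g n)          ≡⟨ cong (_+ (f n + g n)) (sum<-distrib-+ n) ⟩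
    ∑[ i < n ] f i + ∑[ i < n ] g i + (f n + g n)  ≡⟨ solve 4 (λ a b c d → a :+ b :+ (c :+ d) := a :+ c :+ (b :+ d))
                                                          refl (∑[ i < n ] f i) (∑[ i < n ] g i) (f n) (g n) ⟩
    ∑[ i < n ] f i + f n + (∑[ i < n ] g i + g n)  ∎
    where open ≡-Reasoning

sum<-monoˡ-≤ : ∀ (f : ℕ → ℕ) {m n} → m ≤ n → ∑[ i < m ] f i ≤ ∑[ i < n ] f i
sum<-monoˡ-≤ f = go ∘ ≤⇒≤′
  where
  go : ∀ {m n} → m ≤′ n → ∑[ i < m ] f i ≤ ∑[ i < n ] f i
  go ≤′-refl       = ≤-refl
  go (≤′-step m≤n) = ≤-trans (go m≤n) (m≤m+n _ _)

*-distribˡ-sum< : ∀ c (f : ℕ → ℕ) n → c * ∑[ i < n ] f i ≡ ∑[ i < n ] (c * f i)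
*-distribˡ-sum< c f zero    = *-zeroʳ c
*-distribˡ-sum< c f (suc n) =
  trans (*-distribˡ-+ c (∑[ i < n ] f i) (f n)) (cong (_+ c * f n) (*-distribˡ-sum< c f n))

*-distribʳ-sum< : ∀ c (f : ℕ → ℕ) n → (∑[ i < n ] f i) * c ≡ ∑[ i < n ] (f i * c)
*-distribʳ-sum< c f n = begin
  (∑[ i < n ] f i) * c  ≡⟨ *-comm _ c ⟩
  c * ∑[ i < n ] f i    ≡⟨ *-distribˡ-sum< c f n ⟩
  ∑[ i < n ] (c * f i)  ≡⟨ sum<-cong n (λ i _ → *-comm c (f i)) ⟩
  ∑[ i < n ] (f i * c)  ∎
  where open ≡-Reasoning

sum<-suc : ∀ (f : ℕ → ℕ) n → ∑[ i < suc n ] f i ≡ f 0 + ∑[ i < n ] f (suc i)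
sum<-suc f zero    = +-comm 0 (f 0)
sum<-suc f (suc n) =
  trans (cong (_+ f (suc n)) (sum<-suc f n)) (+-assoc (f 0) (∑[ i < n ] f (suc i)) (f (suc n)))

sum<-triangle : ∀ (T : ℕ → ℕ → ℕ) K →
  ∑[ N < suc K ] ∑[ p < suc N ] T p (N ∸ p) ≡ ∑[ p < suc K ] ∑[ q < suc (K ∸ p) ] T p q
sum<-triangle T zero    = refl
sum<-triangle T (suc K) = begin
  ∑[ N < suc K ] ∑[ p < suc N ] T p (N ∸ p) + ∑[ p < suc (suc K) ] T p (suc K ∸ p)
    ≡⟨ cong (_+ ∑[ p < suc (suc K) ] T p (suc K ∸ p)) (sum<-triangle T K) ⟩
  ∑[ p < suc K ] ∑[ q < suc (K ∸ p) ] T p q + (∑[ p < suc K ] T p (suc K ∸ p) + T (suc K) (K ∸ K))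
    ≡⟨ sym (+-assoc (∑[ p < suc K ] ∑[ q < suc (K ∸ p) ] T p q) _ _) ⟩
  ∑[ p < suc K ] ∑[ q < suc (K ∸ p) ] T p q + ∑[ p < suc K ] T p (suc K ∸ p) + T (suc K) (K ∸ K)
    ≡⟨ cong (_+ T (suc K) (K ∸ K)) (sym (sum<-distrib-+ (suc K))) ⟩
  ∑[ p < suc K ] (∑[ q < suc (K ∸ p) ] T p q + T p (suc K ∸ p)) + T (suc K) (K ∸ K)
    ≡⟨ cong₂ _+_ (sum<-cong (suc K) extend) (top K) ⟩
  ∑[ p < suc (suc K) ] ∑[ q < suc (suc K ∸ p) ] T p q ∎
  where
  open ≡-Reasoning
  extend : ∀ p → p < suc K →
    ∑[ q < suc (K ∸ p) ] T p q + T p (suc K ∸ p) ≡ ∑[ q < suc (suc K ∸ p) ] T p q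
  extend p p<1+K rewrite +-∸-assoc 1 (≤-pred p<1+K) = refl
  top : ∀ K → T (suc K) (K ∸ K) ≡ ∑[ q < suc (K ∸ K) ] T (suc K) q
  top K rewrite n∸n≡0 K = refl

module _ (x y : ℕ) where

  private
    foldr≡sum< : ∀ n (g : ℕ → ℕ) (h : Fin n → ℕ) → (∀ k → h k ≡ g (toℕ k)) →
      VecF.foldr _+_ 0 h ≡ ∑[ i < n ] g i
    foldr≡sum< zero    g h h≗g = refl
    foldr≡sum< (suc n) g h h≗g =
      trans (cong₂ _+_ (h≗g fzero) (foldr≡sum< n (g ∘ suc) (h ∘ fsuc) (h≗g ∘ fsuc))) (sym (sum<-suc g n))

    ×≡* : ∀ n a → RawMonoid._×_ (Semiring.+-rawMonoid +-*-semiring) n a ≡ n * a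
    ×≡* zero    a = refl
    ×≡* (suc n) a = cong (a +_) (×≡* n a)

    ^≡^ : ∀ a n → SemiringExp._^_ +-*-semiring a n ≡ a ^ n
    ^≡^ a zero    = refl
    ^≡^ a (suc n) = cong (a *_) (^≡^ a n)

  binomial-theorem : ∀ N → (x + y) ^ N ≡ ∑[ p < suc N ] ((N C p) * (x ^ p * y ^ (N ∸ p)))
  binomial-theorem N = begin
    (x + y) ^ N                                      ≡⟨ sym (^≡^ (x + y) N) ⟩
    SemiringExp._^_ +-*-semiring (x + y) N           ≡⟨ theorem (*-comm x y) N ⟩
    binomialExpansion N                              ≡⟨ foldr≡sum< (suc N) _ _ term≡ ⟩
    ∑[ p < suc N ] ((N C p) * (x ^ p * y ^ (N ∸ p))) ∎
    where
    open ≡-Reasoning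
    open Binomial +-*-semiring x y using (theorem; binomialExpansion; binomialTerm)
    term≡ : ∀ (k : Fin (suc N)) → binomialTerm N k ≡ (N C toℕ k) * (x ^ toℕ k * y ^ (N ∸ toℕ k))
    term≡ k = trans (×≡* (N C toℕ k) _)
      (cong ((N C toℕ k) *_) (cong₂ _*_ (^≡^ x (toℕ k)) (^≡^ y (N ∸ toℕ k))))

-- Partial sums of the exponential series

rising : ℕ → ℕ → ℕ
rising i zero    = 1
rising i (suc d) = suc (i + d) * rising i d

rising-*-! : ∀ i d → rising i d * i ! ≡ (i + d) !
rising-*-! i zero    = trans (+-identityʳ (i !)) (cong _! (sym (+-identityʳ i)))
rising-*-! i (suc d) = begin
  suc (i + d) * rising i d * i !   ≡⟨ *-assoc (suc (i + d)) (rising i d) (i !) ⟩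
  suc (i + d) * (rising i d * i !) ≡⟨ cong (suc (i + d) *_) (rising-*-! i d) ⟩
  suc (i + d) !                    ≡⟨ cong _! (sym (+-suc i d)) ⟩
  (i + suc d) !                    ∎
  where open ≡-Reasoning

factQuot : ℕ → ℕ → ℕ
factQuot k i = rising i (k ∸ i)

factQuot-*-! : ∀ {i k} → i ≤ k → factQuot k i * i ! ≡ k !
factQuot-*-! {i} {k} i≤k = trans (rising-*-! i (k ∸ i)) (cong _! (m+[n∸m]≡n i≤k))

factQuot-suc : ∀ {i k} → i ≤ k → factQuot (suc k) i ≡ suc k * factQuot k i
factQuot-suc {i} {k} i≤k rewrite +-∸-assoc 1 i≤k | m+[n∸m]≡n i≤k = refl

factQuot-diag : ∀ k → factQuot k k ≡ 1
factQuot-diag k rewrite n∸n≡0 k = refl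

nCk*k!*[n∸k]!≡n! : ∀ {n k} → k ≤ n → (n C k) * (k ! * (n ∸ k) !) ≡ n !
nCk*k!*[n∸k]!≡n! {n} {k} k≤n =
  trans (cong (_* (k ! * (n ∸ k) !)) (nCk≡n!/k![n-k]! k≤n))
        (m/n*n≡m {{k !* (n ∸ k) !≢0}} (k![n∸k]!∣n! k≤n))

nCk*factQuot : ∀ {N p k} → p ≤ N → N ≤ k →
  (N C p) * factQuot k N * k ! ≡ factQuot k p * factQuot k (N ∸ p)
nCk*factQuot {N} {p} {k} p≤N N≤k = *-cancelʳ-≡ _ _ (p ! * (N ∸ p) !) {{p !* (N ∸ p) !≢0}} (begin
  (N C p) * factQuot k N * k ! * (p ! * (N ∸ p) !)
    ≡⟨ solve 5 (λ c f g a b → c :* f :* g :* (a :* b) := c :* (a :* b) :* f :* g)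
               refl (N C p) (factQuot k N) (k !) (p !) ((N ∸ p) !) ⟩
  (N C p) * (p ! * (N ∸ p) !) * factQuot k N * k !
    ≡⟨ cong (λ z → z * factQuot k N * k !) (nCk*k!*[n∸k]!≡n! p≤N) ⟩
  N ! * factQuot k N * k !
    ≡⟨ cong (_* k !) (trans (*-comm (N !) (factQuot k N)) (factQuot-*-! N≤k)) ⟩
  k ! * k !
    ≡⟨ sym (cong₂ _*_ (factQuot-*-! (≤-trans p≤N N≤k)) (factQuot-*-! (≤-trans (m∸n≤m N p) N≤k))) ⟩
  factQuot k p * p ! * (factQuot k (N ∸ p) * (N ∸ p) !)
    ≡⟨ solve 4 (λ f a g b → f :* a :* (g :* b) := f :* g :* (a :* b))
               refl (factQuot k p) (p !) (factQuot k (N ∸ p)) ((N ∸ p) !) ⟩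
  factQuot k p * factQuot k (N ∸ p) * (p ! * (N ∸ p) !) ∎)
  where open ≡-Reasoning

-- k! · Σ_{i ≤ k} xⁱ / i!, the numerator of expPartial x k over k!.
expNum : ℕ → ℕ → ℕ
expNum x k = ∑[ i < suc k ] (x ^ i * factQuot k i)

expNum-suc : ∀ x k → expNum x (suc k) ≡ suc k * expNum x k + x ^ suc k
expNum-suc x k = cong₂ _+_
  (trans (sum<-cong (suc k) (λ i i≤k → trans (cong (x ^ i *_) (factQuot-suc (≤-pred i≤k)))
                                             (x*[y*z]≡y*[x*z] (x ^ i) (suc k) (factQuot k i))))
         (sym (*-distribˡ-sum< (suc k) _ (suc k))))
  (trans (cong (x ^ suc k *_) (factQuot-diag (suc k))) (*-identityʳ _))
  where
  x*[y*z]≡y*[x*z] : ∀ a b c → a * (b * c) ≡ b * (a * c)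
  x*[y*z]≡y*[x*z] = solve 3 (λ a b c → a :* (b :* c) := b :* (a :* c)) refl

expNum-zeroˡ : ∀ k → expNum 0 k ≡ k !
expNum-zeroˡ zero    = refl
expNum-zeroˡ (suc k) = trans (expNum-suc 0 k) (trans (+-identityʳ _) (cong (suc k *_) (expNum-zeroˡ k)))

expNum-monoˡ-≤ : ∀ {x y} k → x ≤ y → expNum x k ≤ expNum y k
expNum-monoˡ-≤ k x≤y = sum<-mono-≤ (suc k) (λ i _ → *-monoˡ-≤ _ (^-monoˡ-≤ i x≤y))

^≤expNum : ∀ x k → x ^ k ≤ expNum x k
^≤expNum x k = begin
  x ^ k                  ≡⟨ sym (*-identityʳ (x ^ k)) ⟩
  x ^ k * 1              ≡⟨ cong (x ^ k *_) (sym (factQuot-diag k)) ⟩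
  x ^ k * factQuot k k   ≤⟨ m≤n+m _ _ ⟩
  expNum x k             ∎
  where open ≤-Reasoning

module _ (x y k : ℕ) where

  private
    T : ℕ → ℕ → ℕ
    T p q = (x ^ p * factQuot k p) * (y ^ q * factQuot k q)

  binomial-factQuot : ∀ N → N ≤ k →
    (x + y) ^ N * factQuot k N * k ! ≡ ∑[ p < suc N ] T p (N ∸ p)
  binomial-factQuot N N≤k = begin
    (x + y) ^ N * factQuot k N * k !
      ≡⟨ cong (λ z → z * factQuot k N * k !) (binomial-theorem x y N) ⟩
    (∑[ p < suc N ] ((N C p) * (x ^ p * y ^ (N ∸ p)))) * factQuot k N * k !
      ≡⟨ cong (_* k !) (*-distribʳ-sum< (factQuot k N) _ (suc N)) ⟩
    (∑[ p < suc N ] ((N C p) * (x ^ p * y ^ (N ∸ p)) * factQuot k N)) * k !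
      ≡⟨ *-distribʳ-sum< (k !) _ (suc N) ⟩
    ∑[ p < suc N ] ((N C p) * (x ^ p * y ^ (N ∸ p)) * factQuot k N * k !)
      ≡⟨ sum<-cong (suc N) (λ p p≤N → term p (≤-pred p≤N)) ⟩
    ∑[ p < suc N ] T p (N ∸ p) ∎
    where
    open ≡-Reasoning
    term : ∀ p → p ≤ N → (N C p) * (x ^ p * y ^ (N ∸ p)) * factQuot k N * k ! ≡ T p (N ∸ p)
    term p p≤N = begin
      (N C p) * (x ^ p * y ^ (N ∸ p)) * factQuot k N * k !
        ≡⟨ solve 5 (λ c a b f g → c :* (a :* b) :* f :* g := a :* b :* (c :* f :* g))
                   refl (N C p) (x ^ p) (y ^ (N ∸ p)) (factQuot k N) (k !) ⟩
      x ^ p * y ^ (N ∸ p) * ((N C p) * factQuot k N * k !)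
        ≡⟨ cong (x ^ p * y ^ (N ∸ p) *_) (nCk*factQuot p≤N N≤k) ⟩
      x ^ p * y ^ (N ∸ p) * (factQuot k p * factQuot k (N ∸ p))
        ≡⟨ solve 4 (λ a b f g → a :* b :* (f :* g) := a :* f :* (b :* g))
                   refl (x ^ p) (y ^ (N ∸ p)) (factQuot k p) (factQuot k (N ∸ p)) ⟩
      T p (N ∸ p) ∎

  expNum-+ : expNum (x + y) k * k ! ≤ expNum x k * expNum y k
  expNum-+ = begin
    expNum (x + y) k * k !
      ≡⟨ *-distribʳ-sum< (k !) _ (suc k) ⟩
    ∑[ N < suc k ] ((x + y) ^ N * factQuot k N * k !)
      ≡⟨ sum<-cong (suc k) (λ N N≤k → binomial-factQuot N (≤-pred N≤k)) ⟩
    ∑[ N < suc k ] ∑[ p < suc N ] T p (N ∸ p)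
      ≡⟨ sum<-triangle T k ⟩
    ∑[ p < suc k ] ∑[ q < suc (k ∸ p) ] T p q
      ≤⟨ sum<-mono-≤ (suc k) (λ p _ → sum<-monoˡ-≤ (T p) (s≤s (m∸n≤m k p))) ⟩
    ∑[ p < suc k ] ∑[ q < suc k ] T p q
      ≡⟨ sum<-cong (suc k) (λ p _ → sym (*-distribˡ-sum< (x ^ p * factQuot k p) _ (suc k))) ⟩
    ∑[ p < suc k ] (x ^ p * factQuot k p * expNum y k)
      ≡⟨ sym (*-distribʳ-sum< (expNum y k) _ (suc k)) ⟩
    expNum x k * expNum y k ∎
    where open ≤-Reasoning

^-distribʳ-* : ∀ a b n → (a * b) ^ n ≡ a ^ n * b ^ n
^-distribʳ-* a b zero    = refl
^-distribʳ-* a b (suc n) rewrite ^-distribʳ-* a b n =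
  solve 4 (λ a b c d → a :* b :* (c :* d) := a :* c :* (b :* d)) refl a b (a ^ n) (b ^ n)

expNum-*ˡ : ∀ {x M} → (∀ k → expNum x k ≤ M * k !) → ∀ N k → expNum (N * x) k ≤ M ^ N * k !
expNum-*ˡ {x} {M} bound N k =
  *-cancelʳ-≤ (expNum (N * x) k) (M ^ N * k !) ((k !) ^ N) {{m^n≢0 (k !) N {{k !≢0}}}} (begin
    expNum (N * x) k * (k !) ^ N        ≤⟨ power N ⟩
    expNum x k ^ N * k !                ≤⟨ *-monoˡ-≤ (k !) (^-monoˡ-≤ N (bound k)) ⟩
    (M * k !) ^ N * k !                 ≡⟨ cong (_* k !) (^-distribʳ-* M (k !) N) ⟩
    M ^ N * (k !) ^ N * k !             ≡⟨ solve 3 (λ a b c → a :* b :* c := a :* c :* b) refl (M ^ N) ((k !) ^ N) (k !) ⟩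
    M ^ N * k ! * (k !) ^ N             ∎)
  where
  open ≤-Reasoning
  power : ∀ N → expNum (N * x) k * (k !) ^ N ≤ expNum x k ^ N * k !
  power zero    = ≤-reflexive (trans (*-identityʳ _) (trans (expNum-zeroˡ k) (sym (*-identityˡ _))))
  power (suc N) = begin
    expNum (x + N * x) k * (k ! * (k !) ^ N)   ≡⟨ sym (*-assoc (expNum (x + N * x) k) (k !) ((k !) ^ N)) ⟩
    expNum (x + N * x) k * k ! * (k !) ^ N     ≤⟨ *-monoˡ-≤ ((k !) ^ N) (expNum-+ x (N * x) k) ⟩
    expNum x k * expNum (N * x) k * (k !) ^ N  ≡⟨ *-assoc (expNum x k) _ _ ⟩
    expNum x k * (expNum (N * x) k * (k !) ^ N) ≤⟨ *-monoʳ-≤ (expNum x k) (power N) ⟩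
    expNum x k * (expNum x k ^ N * k !)        ≡⟨ sym (*-assoc (expNum x k) _ _) ⟩
    expNum x k ^ suc N * k !                   ∎

private
  frac : ℕ → (d : ℕ) → .{{NonZero d}} → ℚᵘ
  frac p d = (ℤ.+ p) ℚᵘ./ d

  toℚᵘ-/ : ∀ p d .{{_ : NonZero d}} → ℚ.toℚᵘ ((ℤ.+ p) ℚ./ d) ℚᵘ.≃ frac p d
  toℚᵘ-/ p (suc d) = ℚP.toℚᵘ-fromℚᵘ (mkℚᵘ (ℤ.+ p) d)

  frac-cong : ∀ p q d e .{{_ : NonZero d}} .{{_ : NonZero e}} →
    p * e ≡ q * d → frac p d ℚᵘ.≃ frac q e
  frac-cong p q (suc d) (suc e) eq = *≡* (trans (sym (ℤP.pos-* p (suc e))) (trans (cong ℤ.+_ eq) (ℤP.pos-* q (suc d))))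

  frac-≤⁻ : ∀ p q d e .{{_ : NonZero d}} .{{_ : NonZero e}} →
    frac p d ℚᵘ.≤ frac q e → p * e ≤ q * d
  frac-≤⁻ p q (suc d) (suc e) (*≤* le) =
    ℤP.drop‿+≤+ (subst₂ ℤ._≤_ (sym (ℤP.pos-* p (suc e))) (sym (ℤP.pos-* q (suc d))) le)

  frac-≤⁺ : ∀ p q d e .{{_ : NonZero d}} .{{_ : NonZero e}} →
    p * e ≤ q * d → frac p d ℚᵘ.≤ frac q e
  frac-≤⁺ p q (suc d) (suc e) le = *≤* (subst₂ ℤ._≤_ (ℤP.pos-* p (suc e)) (ℤP.pos-* q (suc d)) (ℤ.+≤+ le))

  frac-+ : ∀ p q d e .{{_ : NonZero d}} .{{_ : NonZero e}} →
    frac p d ℚᵘ.+ frac q e ℚᵘ.≃ frac (p * e + q * d) (d * e) {{m*n≢0 d e}}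
  frac-+ p q (suc d) (suc e) = *≡* (cong (ℤ._* (ℤ.+ (suc d * suc e)))
    (sym (trans (ℤP.pos-+ (p * suc e) (q * suc d)) (cong₂ ℤ._+_ (ℤP.pos-* p (suc e)) (ℤP.pos-* q (suc d))))))

toℚᵘ-expPartial : ∀ a k → ℚ.toℚᵘ (expPartial a k) ℚᵘ.≃ frac (expNum a k) (k !) {{k !≢0}}
toℚᵘ-expPartial a zero    = ℚᵘP.≃-refl
toℚᵘ-expPartial a (suc k) = begin-equality
  ℚ.toℚᵘ (expPartial a (suc k))
    ≃⟨ ℚP.toℚᵘ-homo-+ (expPartial a k) _ ⟩
  ℚ.toℚᵘ (expPartial a k) ℚᵘ.+ ℚ.toℚᵘ ((ℤ.+ (a ^ suc k)) ℚ./ (suc k !))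
    ≃⟨ ℚᵘP.+-cong (toℚᵘ-expPartial a k) (toℚᵘ-/ (a ^ suc k) (suc k !)) ⟩
  frac (expNum a k) (k !) ℚᵘ.+ frac (a ^ suc k) (suc k !)
    ≃⟨ frac-+ (expNum a k) (a ^ suc k) (k !) (suc k !) ⟩
  frac (expNum a k * suc k ! + a ^ suc k * k !) (k ! * suc k !) {{m*n≢0 (k !) (suc k !)}}
    ≃⟨ frac-cong _ _ _ _ {{m*n≢0 (k !) (suc k !)}} cross ⟩
  frac (expNum a (suc k)) (suc k !) ∎
  where
  open ℚᵘP.≤-Reasoning
  instance
    k!≢0 : NonZero (k !)
    k!≢0 = k !≢0
    1+k!≢0 : NonZero (suc k !)
    1+k!≢0 = suc k !≢0
  cross : (expNum a k * suc k ! + a ^ suc k * k !) * suc k ! ≡ expNum a (suc k) * (k ! * suc k !)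
  cross rewrite expNum-suc a k =
    solve 4 (λ g A f k → (g :* ((con 1 :+ k) :* f) :+ A :* f) :* ((con 1 :+ k) :* f)
                     := ((con 1 :+ k) :* g :+ A) :* (f :* ((con 1 :+ k) :* f)))
            refl (expNum a k) (a ^ suc k) (k !) k

ExpLE⇒expNum≤ : ∀ x M → ExpLE x M → ∀ k → expNum x k ≤ M * k !
ExpLE⇒expNum≤ x M exp≤M k = subst (_≤ M * k !) (*-identityʳ (expNum x k))
  (frac-≤⁻ (expNum x k) M (k !) 1 {{k !≢0}}
    (ℚᵘP.≤-respˡ-≃ (toℚᵘ-expPartial x k) (ℚᵘP.≤-respʳ-≃ (toℚᵘ-/ M 1) (ℚP.toℚᵘ-mono-≤ (exp≤M k)))))

expNum≤⇒ExpLE : ∀ x M → (∀ k → expNum x k ≤ M * k !) → ExpLE x M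
expNum≤⇒ExpLE x M bound k = ℚP.toℚᵘ-cancel-≤
  (ℚᵘP.≤-respˡ-≃ (ℚᵘP.≃-sym (toℚᵘ-expPartial x k)) (ℚᵘP.≤-respʳ-≃ (ℚᵘP.≃-sym (toℚᵘ-/ M 1))
    (frac-≤⁺ (expNum x k) M (k !) 1 {{k !≢0}} (subst (_≤ M * k !) (sym (*-identityʳ (expNum x k))) (bound k)))))

ExpLE-zero : ∀ M → 1 ≤ M → ExpLE 0 M
ExpLE-zero M 1≤M = expNum≤⇒ExpLE 0 M λ k → begin
  expNum 0 k  ≡⟨ expNum-zeroˡ k ⟩
  k !         ≡⟨ sym (*-identityˡ (k !)) ⟩
  1 * k !     ≤⟨ *-monoˡ-≤ (k !) 1≤M ⟩
  M * k !     ∎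
  where open ≤-Reasoning

ExpLE-mono : ∀ {x y M M′} → y ≤ x → M ≤ M′ → ExpLE x M → ExpLE y M′
ExpLE-mono {x} {y} {M} {M′} y≤x M≤M′ exp≤M = expNum≤⇒ExpLE y M′ λ k →
  ≤-trans (expNum-monoˡ-≤ k y≤x) (≤-trans (ExpLE⇒expNum≤ x M exp≤M k) (*-monoˡ-≤ (k !) M≤M′))

ExpLE-*ˡ : ∀ {x M} N → ExpLE x M → ExpLE (N * x) (M ^ N)
ExpLE-*ˡ {x} {M} N exp≤M = expNum≤⇒ExpLE (N * x) (M ^ N) (expNum-*ˡ (ExpLE⇒expNum≤ x M exp≤M) N)

n!≤n^n : ∀ n → n ! ≤ n ^ n
n!≤n^n zero    = ≤-refl
n!≤n^n (suc n) = *-monoʳ-≤ (suc n) (≤-trans (n!≤n^n n) (^-monoˡ-≤ n (n≤1+n n)))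

ExpLE⇒^≤ : ∀ {a M} K t → ExpLE a M → K * t ≤ a → t ^ K ≤ M
ExpLE⇒^≤ {a} {M} K t exp≤M Kt≤a = *-cancelʳ-≤ (t ^ K) M (K !) {{K !≢0}} (begin
  t ^ K * K !      ≤⟨ *-monoʳ-≤ (t ^ K) (n!≤n^n K) ⟩
  t ^ K * K ^ K    ≡⟨ *-comm (t ^ K) (K ^ K) ⟩
  K ^ K * t ^ K    ≡⟨ sym (^-distribʳ-* K t K) ⟩
  (K * t) ^ K      ≤⟨ ^-monoˡ-≤ K Kt≤a ⟩
  a ^ K            ≤⟨ ^≤expNum a K ⟩
  expNum a K       ≤⟨ ExpLE⇒expNum≤ a M exp≤M K ⟩
  M * K !          ∎)
  where open ≤-Reasoning

3m<n⇒n≤3∣2m-n∣ : ∀ {m n} → 3 * m < n → n ≤ 3 * ∣ 2 * m - n ∣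
3m<n⇒n≤3∣2m-n∣ {m} {n} 3m<n = begin
  n                    ≡⟨ sym (m+n∸n≡m n (6 * m)) ⟩
  n + 6 * m ∸ 6 * m    ≤⟨ ∸-monoˡ-≤ (6 * m) n+6m≤3n ⟩
  3 * n ∸ 6 * m        ≡⟨ cong (3 * n ∸_) (*-assoc 3 2 m) ⟩
  3 * n ∸ 3 * (2 * m)  ≡⟨ sym (*-distribˡ-∸ 3 n (2 * m)) ⟩
  3 * (n ∸ 2 * m)      ≡⟨ cong (3 *_) (sym (m≤n⇒∣m-n∣≡n∸m 2m≤n)) ⟩
  3 * ∣ 2 * m - n ∣    ∎
  where
  open ≤-Reasoning
  2m≤n : 2 * m ≤ n
  2m≤n = ≤-trans (*-monoˡ-≤ m {2} {3} (s≤s (s≤s z≤n))) (<⇒≤ 3m<n)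
  n+6m≤3n : n + 6 * m ≤ 3 * n
  n+6m≤3n = begin
    n + 6 * m        ≡⟨ cong (n +_) (*-assoc 2 3 m) ⟩
    n + 2 * (3 * m)  ≤⟨ +-monoʳ-≤ n (*-monoʳ-≤ 2 (<⇒≤ 3m<n)) ⟩
    n + 2 * n        ≡⟨ solve 1 (λ n → n :+ con 2 :* n := con 3 :* n) refl n ⟩
    3 * n            ∎

-- If 3m < n then |2m - n| ≥ n/3, so with q = ⌊n/288⌋ the middle-layer condition gives
-- q^(32n) ≤ exp((n/3)²) ≤ n^(16n); the threshold 288 · 290 makes q² > n, a contradiction.
module _ {n} (N≤n : 288 * 290 ≤ n) where

  290≤n/288 : 290 ≤ n / 288
  290≤n/288 = subst (_≤ n / 288) (m*n/n≡m 290 288) (/-monoˡ-≤ 288 (≤-trans (≤-reflexive (*-comm 290 288)) N≤n))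

  n<[n/288]² : n < n / 288 * (n / 288)
  n<[n/288]² = begin-strict
    n                     ≡⟨ m≡m%n+[m/n]*n n 288 ⟩
    n % 288 + q * 288     <⟨ +-monoˡ-< (q * 288) (<-≤-trans (m%n<n n 288) 288≤2q) ⟩
    2 * q + q * 288       ≡⟨ solve 1 (λ q → con 2 :* q :+ q :* con 288 := q :* con 290) refl q ⟩
    q * 290               ≤⟨ *-monoʳ-≤ q 290≤n/288 ⟩
    q * q                 ∎
    where
    open ≤-Reasoning
    q = n / 288
    288≤2q : 288 ≤ 2 * q
    288≤2q = ≤-trans (m≤m+n 288 292) (*-monoʳ-≤ 2 290≤n/288)

  middle-layer⇒n≤3m : ∀ m → ∣ 2 * m - n ∣ ≤ 4 ·√nlnn[ n ] → n ≤ 3 * m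
  middle-layer⇒n≤3m m in-band with n ≤? 3 * m
  ... | yes n≤3m = n≤3m
  ... | no  n≰3m = contradiction q^32n≤n^16n (<⇒≱ n^16n<q^32n)
    where
    q = n / 288
    D = ∣ 2 * m - n ∣
    n≤3D : n ≤ 3 * D
    n≤3D = 3m<n⇒n≤3∣2m-n∣ {m} (≰⇒> n≰3m)
    32nq≤D² : 32 * n * q ≤ D * D
    32nq≤D² = *-cancelˡ-≤ 9 (begin
      9 * (32 * n * q)   ≡⟨ solve 2 (λ n q → con 9 :* (con 32 :* n :* q) := n :* (q :* con 288)) refl n q ⟩
      n * (q * 288)      ≤⟨ *-monoʳ-≤ n (m/n*n≤m n 288) ⟩
      n * n              ≤⟨ *-mono-≤ n≤3D n≤3D ⟩
      3 * D * (3 * D)    ≡⟨ solve 1 (λ D → con 3 :* D :* (con 3 :* D) := con 9 :* (D :* D)) refl D ⟩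
      9 * (D * D)        ∎)
      where open ≤-Reasoning
    q^32n≤n^16n : q ^ (32 * n) ≤ n ^ (n * 16)
    q^32n≤n^16n = ExpLE⇒^≤ (32 * n) q in-band 32nq≤D²
    n^16n<q^32n : n ^ (n * 16) < q ^ (32 * n)
    n^16n<q^32n = begin-strict
      n ^ (n * 16)          <⟨ ^-monoˡ-< (n * 16) {{m*n≢0 n 16 {{>-nonZero (≤-trans (s≤s z≤n) N≤n)}}}} n<[n/288]² ⟩
      (q * q) ^ (n * 16)    ≡⟨ ^-distribʳ-* q q (n * 16) ⟩
      q ^ (n * 16) * q ^ (n * 16)  ≡⟨ sym (^-distribˡ-+-* q (n * 16) (n * 16)) ⟩
      q ^ (n * 16 + n * 16) ≡⟨ cong (q ^_) (solve 1 (λ n → n :* con 16 :+ n :* con 16 := con 32 :* n) refl n) ⟩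
      q ^ (32 * n)          ∎
      where open ≤-Reasoning

·√nlnn-mono : ∀ {a a′ c c′} n → 1 ≤ n → a′ ≤ a → c ≤ c′ → a ≤ c ·√nlnn[ n ] → a′ ≤ c′ ·√nlnn[ n ]
·√nlnn-mono {a} {a′} {c} {c′} n 1≤n a′≤a c≤c′ =
  ExpLE-mono (*-mono-≤ a′≤a a′≤a) (^-monoʳ-≤ n {{>-nonZero 1≤n}} (*-monoʳ-≤ n (*-mono-≤ c≤c′ c≤c′)))

·√nlnn-*ˡ : ∀ {a} c n m → a ≤ c ·√nlnn[ n ] → (m * a) ≤ (m * c) ·√nlnn[ n ]
·√nlnn-*ˡ {a} c n m a≤c√ =
  ExpLE-mono (≤-reflexive (square-* m a)) (≤-reflexive exponent) (ExpLE-*ˡ (m * m) a≤c√)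
  where
  square-* : ∀ m a → m * a * (m * a) ≡ m * m * (a * a)
  square-* = solve 2 (λ m a → m :* a :* (m :* a) := m :* m :* (a :* a)) refl
  exponent : (n ^ (n * (c * c))) ^ (m * m) ≡ n ^ (n * (m * c * (m * c)))
  exponent = trans (^-*-assoc n (n * (c * c)) (m * m))
    (cong (n ^_) (solve 3 (λ n c m → n :* (c :* c) :* (m :* m) := n :* (m :* c :* (m :* c))) refl n c m))

-- Counting by duplicate-free lists

AtMost : {A : Set} → ℕ → (A → Set) → Set
AtMost {A} B P = (L : List A) → Unique L → All P L → length L ≤ B

module _ {A : Set} where

  atMost-mono : ∀ {B B′} {P Q : A → Set} → B ≤ B′ → (∀ {x} → P x → Q x) → AtMost B Q → AtMost B′ P
  atMost-mono B≤B′ P⊆Q Q≤B L u ps = ≤-trans (Q≤B L u (All.map P⊆Q ps)) B≤B′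

  atMost-inhabited : ∀ {B} {P : A → Set} → (∀ {x} → P x → AtMost B P) → AtMost B P
  atMost-inhabited P⇒≤B []      _ _           = z≤n
  atMost-inhabited P⇒≤B (x ∷ L) u (px ∷ ps) = P⇒≤B px (x ∷ L) u (px ∷ ps)

  atMost-one : ∀ {P : A → Set} → (∀ {x y} → P x → P y → x ≡ y) → AtMost 1 P
  atMost-one P-unique []          _               _             = z≤n
  atMost-one P-unique (x ∷ [])    _               _             = ≤-refl
  atMost-one P-unique (x ∷ y ∷ L) ((x≢y ∷ _) ∷ _) (px ∷ py ∷ _) = contradiction (P-unique px py) x≢y

  private
    record Partition (P Q : A → Set) (L : List A) : Set where
      field
        left right       : List A
        left-unique      : Unique left
        right-unique     : Unique right
        all-left         : All P left
        all-right        : All Q right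
        left⊆            : ∀ {x} → x ∈ left → x ∈ L
        right⊆           : ∀ {x} → x ∈ right → x ∈ L
        length-partition : length L ≡ length left + length right

    fresh : ∀ {x : A} {L L′} → All (x ≢_) L → (∀ {y} → y ∈ L′ → y ∈ L) → All (x ≢_) L′
    fresh x∉L L′⊆L = All.tabulate (λ y∈L′ → All.lookup x∉L (L′⊆L y∈L′))

    ∈-∷ : ∀ {x : A} {L L′} → (∀ {y} → y ∈ L′ → y ∈ L) → ∀ {y} → y ∈ x ∷ L′ → y ∈ x ∷ L
    ∈-∷ L′⊆L (here y≡x)  = here y≡x
    ∈-∷ L′⊆L (there y∈L′) = there (L′⊆L y∈L′)

    partition : ∀ {P Q : A → Set} L → Unique L → All (λ x → P x ⊎ Q x) L → Partition P Q L
    partition []      []          []         = record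
      { left = [] ; right = [] ; left-unique = [] ; right-unique = [] ; all-left = [] ; all-right = []
      ; left⊆ = λ () ; right⊆ = λ () ; length-partition = refl }
    partition (x ∷ L) (x∉L ∷ u) (pq ∷ pqs) with partition L u pqs | pq
    ... | p | inj₁ px = record
      { left = x ∷ left ; right = right
      ; left-unique = fresh x∉L left⊆ ∷ left-unique ; right-unique = right-unique
      ; all-left = px ∷ all-left ; all-right = all-right
      ; left⊆ = ∈-∷ left⊆ ; right⊆ = there ∘′ right⊆
      ; length-partition = cong suc length-partition }
      where open Partition p
    ... | p | inj₂ qx = record
      { left = left ; right = x ∷ right
      ; left-unique = left-unique ; right-unique = fresh x∉L right⊆ ∷ right-unique
      ; all-left = all-left ; all-right = qx ∷ all-right
      ; left⊆ = there ∘′ left⊆ ; right⊆ = ∈-∷ right⊆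
      ; length-partition = trans (cong suc length-partition) (sym (+-suc (length left) (length right))) }
      where open Partition p

  atMost-⊎ : ∀ {a b} {P Q : A → Set} → AtMost a P → AtMost b Q → AtMost (a + b) (λ x → P x ⊎ Q x)
  atMost-⊎ {a} {b} P≤a Q≤b L u pqs = begin
    length L                      ≡⟨ length-partition ⟩
    length left + length right    ≤⟨ +-mono-≤ (P≤a left left-unique all-left) (Q≤b right right-unique all-right) ⟩
    a + b                         ∎
    where
    open ≤-Reasoning
    open Partition (partition L u pqs)

  atMost-Any : ∀ {I : Set} {B} (Ys : List I) {P : I → A → Set} →
    (∀ {y} → y ∈ Ys → AtMost B (P y)) → AtMost (length Ys * B) (λ x → Any (λ y → P y x) Ys)
  atMost-Any []       P≤B []      _ []       = z≤n
  atMost-Any []       P≤B (x ∷ L) _ (() ∷ _)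
  atMost-Any (y ∷ Ys) {P} P≤B = atMost-mono ≤-refl split
    (atMost-⊎ (P≤B (here refl)) (atMost-Any Ys (λ y∈Ys → P≤B (there y∈Ys))))
    where
    split : ∀ {x} → Any (λ y → P y x) (y ∷ Ys) → P y x ⊎ Any (λ y → P y x) Ys
    split (here p)  = inj₁ p
    split (there p) = inj₂ p

  atMost-injection : ∀ {A′ : Set} {B} {P : A → Set} {Q : A′ → Set} (f : A → A′) →
    (∀ {x y} → P x → P y → f x ≡ f y → x ≡ y) → (∀ {x} → P x → Q (f x)) →
    AtMost B Q → AtMost B P
  atMost-injection {P = P} f f-injective P⇒Q Q≤B L u ps =
    subst (_≤ _) (length-map f L) (Q≤B (map f L) (map-unique u ps) (All.map⁺ (All.map P⇒Q ps)))
    where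
    map-unique : ∀ {L} → Unique L → All P L → Unique (map f L)
    map-unique []          []         = []
    map-unique (x∉L ∷ u) (px ∷ ps) =
      All.map⁺ (All.zipWith (λ (py , x≢y) fx≡fy → x≢y (f-injective px py fx≡fy)) (ps , x∉L)) ∷ map-unique u ps

private variable n : ℕ

elements : Subset n → List (Fin n)
elements []            = []
elements (inside  ∷ p) = fzero ∷ map fsuc (elements p)
elements (outside ∷ p) = map fsuc (elements p)

length-elements : (p : Subset n) → length (elements p) ≡ ∣ p ∣
length-elements []            = refl
length-elements (inside  ∷ p) = cong suc (trans (length-map fsuc (elements p)) (length-elements p))
length-elements (outside ∷ p) = trans (length-map fsuc (elements p)) (length-elements p)

∈-elements⁺ : ∀ {p : Subset n} {x} → x ∈ₛ p → x ∈ elements p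
∈-elements⁺ {p = inside  ∷ p} here        = here refl
∈-elements⁺ {p = inside  ∷ p} (there x∈p) = there (∈-map⁺ fsuc (∈-elements⁺ x∈p))
∈-elements⁺ {p = outside ∷ p} (there x∈p) = ∈-map⁺ fsuc (∈-elements⁺ x∈p)

∈-elements⁻ : ∀ {p : Subset n} {x} → x ∈ elements p → x ∈ₛ p
∈-elements⁻ {p = inside ∷ p} (here refl) = here
∈-elements⁻ {p = inside ∷ p} (there x∈) with ∈-map⁻ fsuc x∈
... | _ , y∈ , refl = there (∈-elements⁻ y∈)
∈-elements⁻ {p = outside ∷ p} x∈ with ∈-map⁻ fsuc x∈
... | _ , y∈ , refl = there (∈-elements⁻ y∈)

⊆∧∣q∣≤∣p∣⇒p≡q : {p q : Subset n} → p ⊆ q → ∣ q ∣ ≤ ∣ p ∣ → p ≡ q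
⊆∧∣q∣≤∣p∣⇒p≡q {p = []}          {[]}          _   _ = refl
⊆∧∣q∣≤∣p∣⇒p≡q {p = inside  ∷ p} {inside  ∷ q} p⊆q ∣q∣≤∣p∣ = cong (inside ∷_) (⊆∧∣q∣≤∣p∣⇒p≡q (drop-∷-⊆ p⊆q) (≤-pred ∣q∣≤∣p∣))
⊆∧∣q∣≤∣p∣⇒p≡q {p = outside ∷ p} {outside ∷ q} p⊆q ∣q∣≤∣p∣ = cong (outside ∷_) (⊆∧∣q∣≤∣p∣⇒p≡q (drop-∷-⊆ p⊆q) ∣q∣≤∣p∣)
⊆∧∣q∣≤∣p∣⇒p≡q {p = inside  ∷ p} {outside ∷ q} p⊆q _ with p⊆q here
... | ()
⊆∧∣q∣≤∣p∣⇒p≡q {p = outside ∷ p} {inside  ∷ q} p⊆q ∣q∣≤∣p∣ =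
  contradiction (≤-trans ∣q∣≤∣p∣ (p⊆q⇒∣p∣≤∣q∣ (drop-∷-⊆ p⊆q))) (<-irrefl refl)

∣p∖x∣+1≡∣p∣ : ∀ {p : Subset n} {x} → x ∈ₛ p → suc ∣ p ∖ x ∣ ≡ ∣ p ∣
∣p∖x∣+1≡∣p∣ {p = inside  ∷ p} {fzero}  here        = cong (suc ∘ ∣_∣) (p─⊥≡p p)
∣p∖x∣+1≡∣p∣ {p = inside  ∷ p} {fsuc x} (there x∈p) = cong suc (∣p∖x∣+1≡∣p∣ x∈p)
∣p∖x∣+1≡∣p∣ {p = outside ∷ p} {fsuc x} (there x∈p) = ∣p∖x∣+1≡∣p∣ x∈p

x∉p∖x : ∀ {p : Subset n} {x} → x ∉ₛ p ∖ x
x∉p∖x {p = _ ∷ p} {fzero}  ()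
x∉p∖x {p = _ ∷ p} {fsuc x} (there x∈p-x) = x∉p∖x x∈p-x

∣p─q∣+∣q∣≡∣p∣ : {p q : Subset n} → q ⊆ p → ∣ p ─ q ∣ + ∣ q ∣ ≡ ∣ p ∣
∣p─q∣+∣q∣≡∣p∣ {p = []}          {[]}          _   = refl
∣p─q∣+∣q∣≡∣p∣ {p = inside  ∷ p} {inside  ∷ q} q⊆p = trans (+-suc _ _) (cong suc (∣p─q∣+∣q∣≡∣p∣ (drop-∷-⊆ q⊆p)))
∣p─q∣+∣q∣≡∣p∣ {p = inside  ∷ p} {outside ∷ q} q⊆p = cong suc (∣p─q∣+∣q∣≡∣p∣ (drop-∷-⊆ q⊆p))
∣p─q∣+∣q∣≡∣p∣ {p = outside ∷ p} {outside ∷ q} q⊆p = ∣p─q∣+∣q∣≡∣p∣ (drop-∷-⊆ q⊆p)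
∣p─q∣+∣q∣≡∣p∣ {p = outside ∷ p} {inside  ∷ q} q⊆p with q⊆p here
... | ()

⊈⇒∃∉ : {p q : Subset n} → ¬ (p ⊆ q) → ∃ λ x → x ∈ₛ p × x ∉ₛ q
⊈⇒∃∉ {p = []}          {[]}          p⊈q = contradiction (λ ()) p⊈q
⊈⇒∃∉ {p = inside  ∷ p} {outside ∷ q} p⊈q = fzero , here , λ ()
⊈⇒∃∉ {p = inside  ∷ p} {inside  ∷ q} p⊈q with ⊈⇒∃∉ (p⊈q ∘ in⊆in)
... | x , x∈p , x∉q = fsuc x , there x∈p , x∉q ∘ drop-there
⊈⇒∃∉ {p = outside ∷ p} {_ ∷ q}       p⊈q with ⊈⇒∃∉ (p⊈q ∘ out⊆)
... | x , x∈p , x∉q = fsuc x , there x∈p , x∉q ∘ drop-there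

⊆∧1+∣p∣≡∣q∣⇒p≡q∖x : {p q : Subset n} → p ⊆ q → suc ∣ p ∣ ≡ ∣ q ∣ → ∃ λ x → x ∈ₛ q × p ≡ q ∖ x
⊆∧1+∣p∣≡∣q∣⇒p≡q∖x {p = p} {q} p⊆q 1+∣p∣≡∣q∣ with ⊈⇒∃∉ q⊈p
  where
  q⊈p : ¬ (q ⊆ p)
  q⊈p q⊆p = <-irrefl refl (≤-trans (≤-reflexive 1+∣p∣≡∣q∣) (p⊆q⇒∣p∣≤∣q∣ q⊆p))
... | x , x∈q , x∉p = x , x∈q , ⊆∧∣q∣≤∣p∣⇒p≡q p⊆q∖x (≤-reflexive (suc-injective (trans (∣p∖x∣+1≡∣p∣ x∈q) (sym 1+∣p∣≡∣q∣))))
  where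
  p⊆q∖x : p ⊆ q ∖ x
  p⊆q∖x y∈p = x∈p∧x≢y⇒x∈p-y (p⊆q y∈p) λ { refl → x∉p y∈p }

-- Full chains

module _ {n : ℕ} where

  private
    V : ℕ → Set
    V k = Vec (Subset n) (suc k)

  record Chain (k : ℕ) (a : Subset n) (M : V k) : Set where
    constructor mkChain
    field
      sizes : ∀ (j : Fin (suc k)) → ∣ lookup M j ∣ ≡ toℕ j
      steps : ∀ (j : Fin k) → lookup M (inject₁ j) ⊆ lookup M (fsuc j)
      top   : lookup M (fromℕ k) ≡ a

  below : ∀ {k} → V (suc k) → V k
  below M = tabulate (lookup M ∘ inject₁)

  coatom : ∀ {k} → V (suc k) → Subset n
  coatom {k} M = lookup M (inject₁ (fromℕ k))

  lookup-below : ∀ {k} (M : V (suc k)) j → lookup (below M) j ≡ lookup M (inject₁ j)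
  lookup-below M = Vec.lookup∘tabulate (lookup M ∘ inject₁)

  chain-card : ∀ {k a} {M : V k} → Chain k a M → ∣ a ∣ ≡ k
  chain-card {k} (mkChain sizes _ top) = trans (cong ∣_∣ (sym top)) (trans (sizes (fromℕ k)) (Fin.toℕ-fromℕ k))

  ascending-⊆ : ∀ {k} (M : V k) → (∀ (j : Fin k) → lookup M (inject₁ j) ⊆ lookup M (fsuc j)) →
    ∀ {i j : Fin (suc k)} → toℕ i ≤ toℕ j → lookup M i ⊆ lookup M j
  ascending-⊆ M           steps {fzero}  {fzero}  _         = id
  ascending-⊆ (_ ∷ _ ∷ M) steps {fzero}  {fsuc j} _         =
    ⊆-trans (steps fzero) (ascending-⊆ (_ ∷ M) (steps ∘ fsuc) {fzero} {j} z≤n)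
  ascending-⊆ (_ ∷ _ ∷ M) steps {fsuc i} {fsuc j} (s≤s i≤j) = ascending-⊆ (_ ∷ M) (steps ∘ fsuc) i≤j

  chain-mono : ∀ {k a} {M : V k} → Chain k a M → ∀ {i j} → toℕ i ≤ toℕ j → lookup M i ⊆ lookup M j
  chain-mono {M = M} (mkChain _ steps _) = ascending-⊆ M steps

  chain-below : ∀ {k a} {M : V (suc k)} → Chain (suc k) a M → Chain k (coatom M) (below M)
  chain-below {k} {M = M} (mkChain sizes steps _) = mkChain sizes′ steps′ (lookup-below M (fromℕ k))
    where
    sizes′ : ∀ j → ∣ lookup (below M) j ∣ ≡ toℕ j
    sizes′ j = trans (cong ∣_∣ (lookup-below M j)) (trans (sizes (inject₁ j)) (Fin.toℕ-inject₁ j))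
    steps′ : ∀ j → lookup (below M) (inject₁ j) ⊆ lookup (below M) (fsuc j)
    steps′ j = subst₂ _⊆_ (sym (lookup-below M (inject₁ j))) (sym (lookup-below M (fsuc j))) (steps (inject₁ j))

  below-injective : ∀ {k a} {M M′ : V (suc k)} → Chain (suc k) a M → Chain (suc k) a M′ →
    below M ≡ below M′ → M ≡ M′
  below-injective {M = M} {M′} (mkChain _ _ top) (mkChain _ _ top′) below≡ =
    trans (sym (Vec.tabulate∘lookup M)) (trans (Vec.tabulate-cong lookup≡) (Vec.tabulate∘lookup M′))
    where
    lookup≡ : ∀ i → lookup M i ≡ lookup M′ i
    lookup≡ i with view i
    ... | ‵fromℕ   = trans top (sym top′)
    ... | ‵inj₁ {i = j} _ =
      trans (sym (lookup-below M j)) (trans (cong (λ L → lookup L j) below≡) (lookup-below M′ j))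

  coatom⊆ : ∀ {k a} {M : V (suc k)} → Chain (suc k) a M → coatom M ⊆ a
  coatom⊆ {k} {M = M} (mkChain _ steps top) = subst (coatom M ⊆_) top (steps (fromℕ k))

  coatom≡∖ : ∀ {k a} {M : V (suc k)} → Chain (suc k) a M → ∃ λ y → y ∈ₛ a × coatom M ≡ a ∖ y
  coatom≡∖ {k} {a} {M} c@(mkChain sizes _ _) = ⊆∧1+∣p∣≡∣q∣⇒p≡q∖x (coatom⊆ c) 1+∣coatom∣≡∣a∣
    where
    1+∣coatom∣≡∣a∣ : suc ∣ coatom M ∣ ≡ ∣ a ∣
    1+∣coatom∣≡∣a∣ = begin
      suc ∣ coatom M ∣                   ≡⟨ cong suc (sizes (inject₁ (fromℕ k))) ⟩
      suc (toℕ (inject₁ (fromℕ k)))      ≡⟨ cong suc (trans (Fin.toℕ-inject₁ (fromℕ k)) (Fin.toℕ-fromℕ k)) ⟩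
      suc k                              ≡⟨ sym (chain-card c) ⟩
      ∣ a ∣                              ∎
      where open ≡-Reasoning

  chain-zero : ∀ {a} {M : V 0} → Chain 0 a M → M ≡ a ∷ []
  chain-zero {M = _ ∷ []} (mkChain _ _ top) = cong (_∷ []) top

  Fibre : ∀ k → Subset n → Fin n → V (suc k) → Set
  Fibre k a y M = Chain (suc k) a M × coatom M ≡ a ∖ y

  atMost-fibre : ∀ {k a y B} {Q : V k → Set} →
    AtMost B (λ M′ → Chain k (a ∖ y) M′ × Q M′) → AtMost B (λ M → Fibre k a y M × Q (below M))
  atMost-fibre {k} = atMost-injection below
    (λ ((c , _) , _) ((c′ , _) , _) → below-injective c c′)
    (λ {M} ((c , coatom≡) , q) → subst (λ b → Chain k b (below M)) coatom≡ (chain-below c) , q)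

  chains-atMost : ∀ k a → AtMost (k !) (Chain k a)
  fibres-atMost : ∀ k a y → AtMost (k !) (Fibre k a y)

  chains-atMost zero    a = atMost-one λ c c′ → trans (chain-zero c) (sym (chain-zero c′))
  chains-atMost (suc k) a = atMost-inhabited λ c →
    atMost-mono (≤-reflexive (cong (_* k !) (trans (length-elements a) (chain-card c)))) classify
      (atMost-Any (elements a) λ {y} _ → fibres-atMost k a y)
    where
    classify : ∀ {M} → Chain (suc k) a M → Any (λ y → Fibre k a y M) (elements a)
    classify c with coatom≡∖ c
    ... | y , y∈a , coatom≡ = Any.map (λ { refl → c , coatom≡ }) (∈-elements⁺ y∈a)

  fibres-atMost k a y = atMost-mono ≤-refl (_, tt)
    (atMost-fibre {Q = λ _ → ⊤} (atMost-mono ≤-refl proj₁ (chains-atMost k (a ∖ y))))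

  chains-avoiding-top : ∀ {k a x B} → x ∈ₛ a → AtMost B (λ M → Chain k a M × x ∉ₛ lookup M (fromℕ k))
  chains-avoiding-top x∈a = atMost-inhabited λ (mkChain _ _ top , x∉top) → contradiction (subst (_ ∈ₛ_) (sym top) x∈a) x∉top

  private
    avoiding-recurrence : ∀ k t → t ≤ k → k ! + k * ((k ∸ t) * (k ∸ 1) !) ≡ (suc k ∸ t) * k !
    avoiding-recurrence zero    zero    z≤n = refl
    avoiding-recurrence (suc k) t       t≤k rewrite +-∸-assoc 1 t≤k =
      cong (suc k ! +_) (trans (sym (*-assoc (suc k) (suc k ∸ t) (k !)))
        (trans (cong (_* k !) (*-comm (suc k) (suc k ∸ t))) (*-assoc (suc k ∸ t) (suc k) (k !))))

  -- Split by the element y removed at the top: for y = x the whole chain below the top lies in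
  -- a ∖ x, otherwise recurse on a ∖ y, which still contains x.
  chains-avoiding : ∀ k {a x} (j : Fin (suc k)) → x ∈ₛ a →
    AtMost ((k ∸ toℕ j) * (k ∸ 1) !) (λ M → Chain k a M × x ∉ₛ lookup M j)
  chains-avoiding zero fzero x∈a = chains-avoiding-top x∈a
  chains-avoiding (suc k) {a} {x} j x∈a with view j
  ... | ‵fromℕ = chains-avoiding-top x∈a
  ... | ‵inj₁ {i = j′} _ = atMost-inhabited λ (c , _) →
    atMost-mono (≤-reflexive (bound c)) classify
      (atMost-⊎ (atMost-fibre {Q = Avoids} (atMost-mono ≤-refl proj₁ (chains-atMost k (a ∖ x))))
                (atMost-Any (elements (a ∖ x)) λ y∈ →
                  atMost-fibre {Q = Avoids} (chains-avoiding k j′ (x∈p∧x≢y⇒x∈p-y x∈a (x≢y y∈)))))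
    where
    x≢y : ∀ {y} → y ∈ elements (a ∖ x) → x ≢ y
    x≢y y∈ refl = x∉p∖x {p = a} (∈-elements⁻ y∈)
    Avoids : V k → Set
    Avoids M′ = x ∉ₛ lookup M′ j′
    classify : ∀ {M} → Chain (suc k) a M × x ∉ₛ lookup M (inject₁ j′) →
      Fibre k a x M × Avoids (below M) ⊎ Any (λ y → Fibre k a y M × Avoids (below M)) (elements (a ∖ x))
    classify {M} (c , x∉) with coatom≡∖ c
    ... | y , y∈a , coatom≡ with y Fin.≟ x
    ...   | yes refl = inj₁ ((c , coatom≡) , x∉ ∘ subst (x ∈ₛ_) (lookup-below M j′))
    ...   | no  y≢x  = inj₂ (Any.map (λ { refl → (c , coatom≡) , x∉ ∘ subst (x ∈ₛ_) (lookup-below M j′) })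
                                (∈-elements⁺ (x∈p∧x≢y⇒x∈p-y y∈a y≢x)))
    bound : ∀ {M} → Chain (suc k) a M →
      k ! + length (elements (a ∖ x)) * ((k ∸ toℕ j′) * (k ∸ 1) !) ≡ (suc k ∸ toℕ (inject₁ j′)) * k !
    bound c = begin
      k ! + length (elements (a ∖ x)) * ((k ∸ toℕ j′) * (k ∸ 1) !)
        ≡⟨ cong (λ m → k ! + m * ((k ∸ toℕ j′) * (k ∸ 1) !)) ∣a∖x∣≡k ⟩
      k ! + k * ((k ∸ toℕ j′) * (k ∸ 1) !)
        ≡⟨ avoiding-recurrence k (toℕ j′) (Fin.toℕ≤pred[n] j′) ⟩
      (suc k ∸ toℕ j′) * k !
        ≡⟨ cong (λ t → (suc k ∸ t) * k !) (sym (Fin.toℕ-inject₁ j′)) ⟩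
      (suc k ∸ toℕ (inject₁ j′)) * k ! ∎
      where
      open ≡-Reasoning
      ∣a∖x∣≡k : length (elements (a ∖ x)) ≡ k
      ∣a∖x∣≡k = suc-injective (trans (cong suc (length-elements (a ∖ x))) (trans (∣p∖x∣+1≡∣p∣ x∈a) (chain-card c)))

  chains-above : ∀ k {a w} → AtMost ((suc k ∸ ∣ w ∣) * k !) (λ M → Chain (suc k) a M × w ⊆ coatom M)
  chains-above k {a} {w} = atMost-inhabited λ (c , w⊆coatom) →
    atMost-mono (≤-reflexive (cong (_* k !) (∣a─w∣≡ c (coatom⊆ c ∘ w⊆coatom)))) classify
      (atMost-Any (elements (a ─ w)) λ {y} _ → fibres-atMost k a y)
    where
    ∣a─w∣≡ : ∀ {M} → Chain (suc k) a M → w ⊆ a → length (elements (a ─ w)) ≡ suc k ∸ ∣ w ∣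
    ∣a─w∣≡ c w⊆a = begin
      length (elements (a ─ w))  ≡⟨ length-elements (a ─ w) ⟩
      ∣ a ─ w ∣                  ≡⟨ sym (m+n∸n≡m ∣ a ─ w ∣ ∣ w ∣) ⟩
      ∣ a ─ w ∣ + ∣ w ∣ ∸ ∣ w ∣  ≡⟨ cong (_∸ ∣ w ∣) (trans (∣p─q∣+∣q∣≡∣p∣ w⊆a) (chain-card c)) ⟩
      suc k ∸ ∣ w ∣              ∎
      where open ≡-Reasoning
    classify : ∀ {M} → Chain (suc k) a M × w ⊆ coatom M → Any (λ y → Fibre k a y M) (elements (a ─ w))
    classify (c , w⊆coatom) with coatom≡∖ c
    ... | y , y∈a , coatom≡ = Any.map (λ { refl → c , coatom≡ })
      (∈-elements⁺ (x∈p∧x∉q⇒x∈p─q y∈a (λ y∈w → x∉p∖x (subst (y ∈ₛ_) coatom≡ (w⊆coatom y∈w)))))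

-- Chains meeting D*(v,S)

least-index : ∀ {A : Set} {m} (R : A → Fin m → Set) {x xs} → All (λ y → ∃ (R y)) (x ∷ xs) →
  ∃ λ i → (∃ λ y → R y i) × All (λ y → ∃ λ j → R y j × toℕ i ≤ toℕ j) (x ∷ xs)
least-index R {x} {[]}     ((j , r) ∷ []) = j , (x , r) , (j , r , ≤-refl) ∷ []
least-index R {x} {_ ∷ _}  ((j , r) ∷ rs) with least-index R rs
... | i , witness , i≤ with toℕ j ≤? toℕ i
...   | yes j≤i = j , (x , r) , (j , r , ≤-refl) ∷ All.map (λ (j′ , r′ , i≤j′) → j′ , r′ , ≤-trans j≤i i≤j′) i≤
...   | no  j≰i = i , witness , (j , r , <⇒≤ (≰⇒> j≰i)) ∷ i≤

∸≤-dist : ∀ n m t {D} → ∣ 2 * m - n ∣ ≤ D → ∣ 2 * t - n ∣ ≤ D → m ∸ t ≤ D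
∸≤-dist n m t {D} dm≤D dt≤D = *-cancelˡ-≤ 2 (begin
  2 * (m ∸ t)                    ≡⟨ *-distribˡ-∸ 2 m t ⟩
  2 * m ∸ 2 * t                  ≤⟨ m∸n≤∣m-n∣ (2 * m) (2 * t) ⟩
  ∣ 2 * m - 2 * t ∣              ≤⟨ ∣-∣-triangle (2 * m) n (2 * t) ⟩
  ∣ 2 * m - n ∣ + ∣ n - 2 * t ∣  ≡⟨ cong (∣ 2 * m - n ∣ +_) (∣-∣-comm n (2 * t)) ⟩
  ∣ 2 * m - n ∣ + ∣ 2 * t - n ∣  ≤⟨ +-mono-≤ dm≤D dt≤D ⟩
  D + D                          ≡⟨ cong (D +_) (sym (+-identityʳ D)) ⟩
  2 * D                          ∎)
  where open ≤-Reasoning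

module _ {n : ℕ} where

  private
    V : ℕ → Set
    V k = Vec (Subset n) (suc k)

  Meets : ∀ {k} → Subset n → List (Subset n) → V k → Set
  Meets v S M = ∃[ j ] InDStar v S (lookup M j)

  ⊆coatom : ∀ {k v} {M : V (suc k)} → Chain (suc k) v M → ∀ {j} → lookup M j ≢ v → lookup M j ⊆ coatom M
  ⊆coatom {k} c {j} M[j]≢v with view j
  ... | ‵fromℕ          = contradiction (Chain.top c) M[j]≢v
  ... | ‵inj₁ {i = j′} _ = chain-mono c
    (subst₂ _≤_ (sym (Fin.toℕ-inject₁ j′)) (sym (trans (Fin.toℕ-inject₁ (fromℕ k)) (Fin.toℕ-fromℕ k)))
                (Fin.toℕ≤pred[n] j′))

  meets-above⇒comparable : ∀ {k v S} {M : V (suc k)} (j* : Fin (2 + k)) → Chain (suc k) v M →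
    (∃ λ j → InDStar v S (lookup M j) × toℕ j* ≤ toℕ j) →
    Any (λ w → lookup M j* ⊆ w ⊎ w ⊆ coatom M) S
  meets-above⇒comparable {M = M} j* c (j , ((_ , M[j]≢v) , comparable , _) , j*≤j) = Any.map reorient comparable
    where
    reorient : ∀ {w} → w ⊆ lookup M j ⊎ lookup M j ⊆ w → lookup M j* ⊆ w ⊎ w ⊆ coatom M
    reorient (inj₁ w⊆M[j]) = inj₂ (⊆coatom c M[j]≢v ∘ w⊆M[j])
    reorient (inj₂ M[j]⊆w) = inj₁ (M[j]⊆w ∘ chain-mono c j*≤j)

  chains-comparable : ∀ k {v w : Subset n} (j* : Fin (2 + k)) → ¬ (v ⊆ w) →
    AtMost ((suc k ∸ toℕ j*) * k ! + (suc k ∸ ∣ w ∣) * k !)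
           (λ M → Chain (suc k) v M × (lookup M j* ⊆ w ⊎ w ⊆ coatom M))
  chains-comparable k {v} {w} j* v⊈w with ⊈⇒∃∉ v⊈w
  ... | x , x∈v , x∉w = atMost-mono ≤-refl split (atMost-⊎ (chains-avoiding (suc k) j* x∈v) (chains-above k))
    where
    split : ∀ {M} → Chain (suc k) v M × (lookup M j* ⊆ w ⊎ w ⊆ coatom M) →
      Chain (suc k) v M × x ∉ₛ lookup M j* ⊎ Chain (suc k) v M × w ⊆ coatom M
    split (c , inj₁ M[j*]⊆w) = inj₁ (c , x∉w ∘ M[j*]⊆w)
    split (c , inj₂ w⊆coatom) = inj₂ (c , w⊆coatom)

  chains-meeting-above : ∀ k {v : Subset n} {S} (j* : Fin (2 + k)) D → suc k ∸ toℕ j* ≤ D →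
    (∀ {w} → w ∈ S → suc k ∸ ∣ w ∣ ≤ D) → (∀ {w} → w ∈ S → ¬ (v ⊆ w)) →
    AtMost (length S * (2 * D * k !))
           (λ M → Chain (suc k) v M × ∃ λ j → InDStar v S (lookup M j) × toℕ j* ≤ toℕ j)
  chains-meeting-above k {v} {S} j* D j*≥ S≥ v⊈S =
    atMost-mono ≤-refl (λ (c , meets) → Any.map (c ,_) (meets-above⇒comparable j* c meets))
      (atMost-Any S λ w∈S → atMost-mono (bound w∈S) id (chains-comparable k j* (v⊈S w∈S)))
    where
    bound : ∀ {w} → w ∈ S → (suc k ∸ toℕ j*) * k ! + (suc k ∸ ∣ w ∣) * k ! ≤ 2 * D * k !
    bound {w} w∈S = begin
      (suc k ∸ toℕ j*) * k ! + (suc k ∸ ∣ w ∣) * k !  ≡⟨ sym (*-distribʳ-+ (k !) (suc k ∸ toℕ j*) _) ⟩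
      (suc k ∸ toℕ j* + (suc k ∸ ∣ w ∣)) * k !        ≤⟨ *-monoˡ-≤ (k !) (+-mono-≤ j*≥ (S≥ w∈S)) ⟩
      (D + D) * k !                                  ≡⟨ cong (λ d → (D + d) * k !) (sym (+-identityʳ D)) ⟩
      2 * D * k !                                    ∎
      where open ≤-Reasoning

ℓn≤6sK!D : ∀ {ℓ s D k n} → ℓ ≤ s * (2 * D * k !) → n ≤ 3 * suc k → ℓ * n ≤ 6 * s * suc k ! * D
ℓn≤6sK!D {ℓ} {s} {D} {k} {n} ℓ≤ n≤ = begin
  ℓ * n                               ≤⟨ *-mono-≤ ℓ≤ n≤ ⟩
  s * (2 * D * k !) * (3 * suc k)     ≡⟨ solve 4 (λ s D f k → s :* (con 2 :* D :* f) :* (con 3 :* (con 1 :+ k))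
                                                  := con 6 :* s :* ((con 1 :+ k) :* f) :* D) refl s D (k !) k ⟩
  6 * s * suc k ! * D                 ∎
  where open ≤-Reasoning

6sf*4≤27sf : ∀ s f → 6 * s * f * 4 ≤ 27 * s * f
6sf*4≤27sf s f = begin
  6 * s * f * 4     ≡⟨ solve 2 (λ s f → con 6 :* s :* f :* con 4 := con 24 :* (s :* f)) refl s f ⟩
  24 * (s * f)      ≤⟨ *-monoˡ-≤ (s * f) {24} {27} (m≤m+n 24 3) ⟩
  27 * (s * f)      ≡⟨ sym (*-assoc 27 s f) ⟩
  27 * s * f        ∎
  where open ≤-Reasoning

module _ {n : ℕ} (N≤n : 288 * 290 ≤ n) where

  private
    V : ℕ → Set
    V k = Vec (Subset n) (suc k)

    1≤n : 1 ≤ n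
    1≤n = ≤-trans (s≤s z≤n) N≤n

    dist : Subset n → ℕ
    dist w = ∣ 2 * ∣ w ∣ - n ∣

  bad-chains-bound-from-level : ∀ k {v : Subset n} {S} (j* : Fin (2 + k)) (u* : Subset n) →
    ∣ v ∣ ≡ suc k → ∣ u* ∣ ≡ toℕ j* → InBand v → InBand u* → All InBand S → (∀ {w} → w ∈ S → ¬ (v ⊆ w)) →
    (bad : List (V (suc k))) → Unique bad →
    All (λ M → Chain (suc k) v M × ∃ λ j → InDStar v S (lookup M j) × toℕ j* ≤ toℕ j) bad →
    (length bad * n) ≤ (27 * length S * suc k !) ·√nlnn[ n ]
  bad-chains-bound-from-level k {v} {S} j* u* ∣v∣≡ ∣u*∣≡ v∈B u*∈B S⊆B v⊈S bad unique chains =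
    ·√nlnn-mono {a = 6 * length S * suc k ! * D} {c = 6 * length S * suc k ! * 4} n 1≤n
      ℓn≤ (6sf*4≤27sf (length S) (suc k !)) (·√nlnn-*ˡ {a = D} 4 n (6 * length S * suc k !) D≤4√)
    where
    w* = argmax dist v (u* ∷ S)
    D = dist w*
    D≤4√ : D ≤ 4 ·√nlnn[ n ]
    D≤4√ = argmax-all dist {P = InBand} v∈B (u*∈B ∷ S⊆B)
    dist≤D : All (λ w → dist w ≤ D) (v ∷ u* ∷ S)
    dist≤D = f[⊥]≤f[argmax] {f = dist} v (u* ∷ S) ∷ f[xs]≤f[argmax] {f = dist} v (u* ∷ S)
    v≤D : ∣ 2 * suc k - n ∣ ≤ D
    v≤D = subst (λ m → ∣ 2 * m - n ∣ ≤ D) ∣v∣≡ (All.head dist≤D)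
    ℓ≤ : length bad ≤ length S * (2 * D * k !)
    ℓ≤ = chains-meeting-above k j* D
           (∸≤-dist n (suc k) (toℕ j*) v≤D (subst (λ m → ∣ 2 * m - n ∣ ≤ D) ∣u*∣≡ (All.head (All.tail dist≤D))))
           (λ {w} w∈S → ∸≤-dist n (suc k) ∣ w ∣ v≤D (All.lookup (All.tail (All.tail dist≤D)) w∈S))
           v⊈S bad unique chains
    ℓn≤ : length bad * n ≤ 6 * length S * suc k ! * D
    ℓn≤ = ℓn≤6sK!D {s = length S} {D} {k} ℓ≤ (subst (λ m → n ≤ 3 * m) ∣v∣≡ (middle-layer⇒n≤3m N≤n ∣ v ∣ v∈B))

  bad-chains-bound : ∀ k {v : Subset n} {S} → InBand v → All InBand S → (∀ {w} → w ∈ S → ¬ (v ⊆ w)) →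
    (bad : List (V k)) → Unique bad → All (λ M → Chain k v M × Meets v S M) bad →
    (length bad * n) ≤ (27 * length S * k !) ·√nlnn[ n ]
  bad-chains-bound k {S = S} v∈B S⊆B v⊈S [] _ _ =
    ExpLE-zero (n ^ (n * (27 * length S * k ! * (27 * length S * k !))))
               (m^n>0 n {{>-nonZero 1≤n}} (n * (27 * length S * k ! * (27 * length S * k !))))
  bad-chains-bound zero {v} v∈B S⊆B v⊈S (_ ∷ _) _ ((c , _) ∷ _) =
    contradiction (≤-trans 1≤n (subst (λ m → n ≤ 3 * m) (chain-card c) (middle-layer⇒n≤3m N≤n ∣ v ∣ v∈B))) (λ ())
  bad-chains-bound (suc k) {v} {S} v∈B S⊆B v⊈S bad@(_ ∷ _) unique chains =
    let j* , (M* , c* , (_ , _ , u*∈B)) , above =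
          least-index (λ M j → Chain (suc k) v M × InDStar v S (lookup M j)) (All.map (λ (c , j , m) → j , c , m) chains)
    in bad-chains-bound-from-level k j* (lookup M* j*) (chain-card c*) (Chain.sizes c* j*) v∈B u*∈B S⊆B v⊈S
         bad unique (All.zipWith (λ ((c , _) , j , (_ , m) , j*≤j) → c , j , m , j*≤j) (chains , above))

lemma3p1 : (s : ℕ) → 1 ≤ s →
  ∃[ N ] ∀ (n : ℕ) → N ≤ n →
    (v : Subset n) (S : List (Subset n)) →
    InBand v → All InBand S → Unique S → length S ≡ s →
    (∀ {w} → w ∈ S → ¬ (v ⊆ w)) →
    (bad : List (Vec (Subset n) (suc ∣ v ∣))) → Unique bad →
    All (λ M → FullChain v M × MeetsDStar v S M) bad →
    (length bad * n) ≤ (27 * s * (∣ v ∣ !)) ·√nlnn[ n ]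
lemma3p1 s _ = 288 * 290 , λ n N≤n v S v∈B S⊆B _ |S|≡s v⊈S bad unique chains →
  subst (λ s → (length bad * n) ≤ (27 * s * (∣ v ∣ !)) ·√nlnn[ n ]) |S|≡s
    (bad-chains-bound N≤n ∣ v ∣ v∈B S⊆B v⊈S bad unique
      (All.map (λ ((sizes , steps , top) , meets) → mkChain sizes steps top , meets) chains))
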